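{- Let $Q$ be a query graph on an $n$-element vertex set $V$ such that, for every hidden tree $T$ on $V$, either the diameter is the same in all trees consistent with the answers of $T$ on $Q$, or there are two vertices whose distance equals the diameter in every tree consistent with those answers. Then the minimum degree of $Q$ is at least $n-3$.
   Context: A tree $T$ is hidden on the known vertex set $V$. A query is an unordered pair of distinct vertices, answered by their distance in $T$; in the non-adaptive setting the set $Q$ of queried pairs (a graph on $V$) is fixed in advance. A tree on $V$ is consistent with the answers if its distance between every pair in $Q$ equals the answer. -}

module Defs where

open import Data.Nat using (ℕ; zero; suc; _≤_; _∸_)
open import Data.Fin using (Fin)
open import Data.Bool using (Bool; true; false; if_then_else_)
open import Data.List using (List; []; _∷_; _++_; [_]; length; map; allFin)
open import Data.Nat.ListAction using (sum)
open import Data.List.Relation.Unary.Linked using (Linked)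
open import Data.List.Relation.Unary.Unique.Propositional using (Unique)
open import Data.Product using (Σ; ∃; ∃-syntax; _×_; _,_)
open import Data.Sum using (_⊎_)
open import Relation.Binary.PropositionalEquality using (_≡_; _≢_)
open import Relation.Nullary using (¬_)

record Graph (n : ℕ) : Set where
  field
    adj    : Fin n → Fin n → Bool
    sym    : ∀ u v → adj u v ≡ adj v u
    irrefl : ∀ u → adj u u ≡ false
open Graph public

Adj : ∀ {n} → Graph n → Fin n → Fin n → Set
Adj G u v = adj G u v ≡ true

data Walk {n : ℕ} (G : Graph n) : Fin n → Fin n → ℕ → Set where
  nil  : ∀ {u} → Walk G u u 0
  cons : ∀ {u w v k} → Adj G u w → Walk G w v k → Walk G u v (suc k)

Dist : ∀ {n} → Graph n → Fin n → Fin n → ℕ → Set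
Dist G u v k = Walk G u v k × (∀ j → Walk G u v j → k ≤ j)

Connected : ∀ {n} → Graph n → Set
Connected G = ∀ u v → ∃[ k ] Walk G u v k

HasCycle : ∀ {n} → Graph n → Set
HasCycle {n} G =
  Σ (Fin n) λ x → Σ (List (Fin n)) λ ys → Σ (Fin n) λ y →
    1 ≤ length ys × Unique (x ∷ ys ++ [ y ]) × Linked (Adj G) (x ∷ ys ++ [ y ]) × Adj G y x

IsTree : ∀ {n} → Graph n → Set
IsTree G = Connected G × ¬ HasCycle G

Diam : ∀ {n} → Graph n → ℕ → Set
Diam {n} G D = (∃[ u ] ∃[ v ] Dist G u v D) × (∀ u v k → Dist G u v k → k ≤ D)

Consistent : ∀ {n} → Graph n → Graph n → Graph n → Set
Consistent {n} Q T T' = IsTree T' × (∀ u v → Adj Q u v → ∀ k → Dist T u v k → Dist T' u v k)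

DiamDetermined : ∀ {n} → Graph n → Graph n → Set
DiamDetermined {n} Q T =
  (∀ T₁ T₂ → Consistent Q T T₁ → Consistent Q T T₂ →
     ∀ D₁ D₂ → Diam T₁ D₁ → Diam T₂ D₂ → D₁ ≡ D₂)
  ⊎ (∃[ u ] ∃[ v ] (u ≢ v × (∀ T' → Consistent Q T T' → ∀ D → Diam T' D → Dist T' u v D)))

degree : ∀ {n} → Graph n → Fin n → ℕ
degree {n} G u = sum (map (λ v → if adj G u v then 1 else 0) (allFin n))

module Submission where

-- If v misses three other vertices a, b, c in Q, we build trees that give the same answers on
-- Q but violate both alternatives of the hypothesis.  They differ only in where v hangs, at
-- places equidistant from every vertex other than a, b, c, so only the unqueried distances
-- from v to a, b, c change.  With a fifth vertex x: the tree c–a–x–b with all remaining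
-- vertices as leaves at x, and v hung at a (diameter 3) or at b (diameter 4, attained only by
-- v, c).  With four vertices: the path b–a–c with v hung at a, b or c (diameters 2, 3, 3, the
-- last two attained only by v, c and by v, b).
--
-- The remaining vertices form one class of twin leaves, so each tree is given by a distance
-- matrix on classes whose tree properties are checked by computation.  Distances in the
-- blown-up graph follow from a potential argument, and acyclicity from levellings: rooted at a
-- vertex x, a cycle through x would have to climb from one neighbour of x to the other.

open import Defs hiding (sym)
open import Data.Bool using (Bool; true; false; T; if_then_else_)
import Data.Bool as Bool
open import Data.Bool.Properties using (T-≡)
open import Data.Empty using (⊥; ⊥-elim)
open import Data.Fin using (Fin; zero; suc; _≟_; #_)
open import Data.Fin.Properties using (any?; all?)
open import Data.List using (List; []; _∷_; _++_; [_]; length; filter; allFin)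
import Data.List as List
open import Data.List.Properties using (length-tabulate)
open import Data.List.Membership.Propositional using (_∈_; _∉_)
open import Data.List.Membership.Propositional.Properties using (∈-++⁺ʳ; ∈-lookup)
open import Data.List.Relation.Unary.All using (All; []; _∷_)
import Data.List.Relation.Unary.All as All
open import Data.List.Relation.Unary.All.Properties as All using (all-filter; All¬⇒¬Any; ¬Any⇒All¬)
open import Data.List.Relation.Unary.AllPairs using ([]; _∷_)
import Data.List.Relation.Unary.AllPairs as AllPairs
open import Data.List.Relation.Unary.Any using (here; there; index)
open import Data.List.Relation.Unary.Any.Properties using (lookup-index)
open import Data.List.Relation.Unary.Linked as Linked using (Linked; [-]; _∷_)
open import Data.List.Relation.Unary.Linked.Properties using (Linked⇒AllPairs)
open import Data.List.Relation.Unary.Unique.Propositional using (Unique)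
open import Data.List.Relation.Unary.Unique.Propositional.Properties as Unique using (allFin⁺)
open import Data.Nat using (ℕ; zero; suc; _≤_; _<_; _∸_; _+_; z≤n; s≤s; _≤?_; _≡ᵇ_)
  renaming (_≟_ to _≟ℕ_)
open import Data.Nat.ListAction using (sum)
open import Data.Nat.Properties using (≤-refl; ≤-antisym; ≤-trans; ≤-reflexive; <-trans; <-irrefl;
  suc-injective; m≤n⇒m≤1+n; n≤1+n; ≡ᵇ⇒≡; ≡⇒≡ᵇ; +-suc; ∸-monoˡ-≤; +-monoʳ-≤; ≤-pred; ≰⇒>; m+n∸n≡m;
  module ≤-Reasoning)
open import Data.Product using (∃-syntax; _×_; _,_; proj₁)
open import Data.Sum using (_⊎_; inj₁; inj₂)
open import Data.Vec using (Vec; []; _∷_; lookup)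
open import Function using (_on_; _∘_)
open import Function.Bundles using (Equivalence)
open import Relation.Binary.PropositionalEquality
  using (_≡_; _≢_; ≢-sym; refl; sym; trans; cong; cong₂; subst; subst₂)
open import Relation.Nullary using (¬_; Dec; yes; no; contradiction)
open import Relation.Nullary.Decidable
  using (_×-dec_; _⊎-dec_; _→-dec_; ¬?; map′; T?; from-yes; decidable-stable)

private
  variable
    n : ℕ

Dist-unique : ∀ {G : Graph n} {u w j k} → Dist G u w j → Dist G u w k → j ≡ k
Dist-unique (walk , shortest) (walk′ , shortest′) = ≤-antisym (shortest _ walk′) (shortest′ _ walk)

module _ {G : Graph n} (w : Fin n) (φ : Fin n → ℕ) (φ-target : φ w ≡ 0)
  (φ-lipschitz : ∀ {u m} → Adj G u m → φ u ≤ suc (φ m))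
  (φ-descent : ∀ {u} → u ≢ w → ∃[ m ] Adj G u m × φ u ≡ suc (φ m)) where

  private
    descending-walk : ∀ k u → φ u ≡ k → Walk G u w k
    descending-walk k u φu≡k with u ≟ w
    ... | yes refl = subst (Walk G w w) (trans (sym φ-target) φu≡k) nil
    ... | no u≢w with φ-descent u≢w
    descending-walk zero    u φu≡0 | no _ | m , _ , φu≡1+φm with () ← trans (sym φu≡0) φu≡1+φm
    descending-walk (suc k) u φu≡k | no _ | m , u~m , φu≡1+φm =
      cons u~m (descending-walk k m (suc-injective (trans (sym φu≡1+φm) φu≡k)))

    walk-bound : ∀ {u k} → Walk G u w k → φ u ≤ k
    walk-bound nil          = ≤-reflexive φ-target
    walk-bound (cons u~m p) = ≤-trans (φ-lipschitz u~m) (s≤s (walk-bound p))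

  potential⇒Dist : ∀ u → Dist G u w (φ u)
  potential⇒Dist u = descending-walk (φ u) u refl , λ _ → walk-bound

adj-sym : ∀ (G : Graph n) {u w} → Adj G u w → Adj G w u
adj-sym G {u} {w} u~w = trans (Graph.sym G w u) u~w

Leaf : Graph n → Fin n → Set
Leaf G x = ∀ {y z} → Adj G x y → Adj G x z → y ≡ z

record RootedLevelling (G : Graph n) (x : Fin n) : Set where
  field
    level         : Fin n → ℕ
    level-root    : level x ≡ 0
    level-step    : ∀ {u w} → Adj G u w → level w ≡ suc (level u) ⊎ level u ≡ suc (level w)
    parent-unique : ∀ {u w w′} → Adj G u w → Adj G u w′ →
                    level u ≡ suc (level w) → level u ≡ suc (level w′) → w ≡ w′

module _ {G : Graph n} {x : Fin n} (L : RootedLevelling G x) where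
  open RootedLevelling L

  private
    Up : Fin n → Fin n → Set
    Up a b = level b ≡ suc (level a)

    climb : ∀ {a b} r → Unique (a ∷ b ∷ r) → Linked (Adj G) (a ∷ b ∷ r) → Up a b → Linked Up (a ∷ b ∷ r)
    climb []      _                          (a~b ∷ [-])     up = up ∷ [-]
    climb (c ∷ r) ((_ ∷ a≢c ∷ _) ∷ distinct) (a~b ∷ b~c ∷ p) up with level-step b~c
    ... | inj₁ up′  = up ∷ climb r distinct (b~c ∷ p) up′
    ... | inj₂ down = contradiction (parent-unique (adj-sym G a~b) b~c up down) a≢c

    neighbour-of-root : ∀ {y} → Adj G x y → level y ≡ 1
    neighbour-of-root x~y with level-step x~y
    ... | inj₁ up   = trans up (cong suc level-root)
    ... | inj₂ down with () ← trans (sym level-root) down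

  no-cycle-through-root : ∀ ys y → 1 ≤ length ys → Unique (x ∷ ys ++ [ y ]) →
    Linked (Adj G) (x ∷ ys ++ [ y ]) → Adj G y x → ⊥
  no-cycle-through-root (x₁ ∷ ys) y _ distinct path@(x~x₁ ∷ _) y~x =
    <-irrefl (trans (neighbour-of-root x~x₁) (sym (neighbour-of-root (adj-sym G y~x)))) x₁<y
    where
      increasing : Linked (_<_ on level) (x ∷ x₁ ∷ ys ++ [ y ])
      increasing = Linked.map (λ up → ≤-reflexive (sym up))
        (climb (ys ++ [ y ]) distinct path (trans (neighbour-of-root x~x₁) (sym (cong suc level-root))))
      x₁<y : level x₁ < level y
      x₁<y with Linked⇒AllPairs <-trans increasing
      ... | _ ∷ (above-x₁ ∷ _) = All.lookup above-x₁ (∈-++⁺ʳ ys (here refl))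

levelled⇒acyclic : ∀ {G : Graph n} → (∀ x → Leaf G x ⊎ RootedLevelling G x) → ¬ HasCycle G
levelled⇒acyclic leaf-or-root (x , ys , y , nonempty , distinct , path , y~x) with leaf-or-root x
... | inj₂ L = no-cycle-through-root L ys y nonempty distinct path y~x
levelled⇒acyclic {G = G} _ (x , x₁ ∷ ys , y , _ , _ ∷ x₁∉rest ∷ _ , x~x₁ ∷ _ , y~x) | inj₁ leaf =
  All.lookup x₁∉rest (∈-++⁺ʳ ys (here refl)) (leaf x~x₁ (adj-sym G y~x))

¬diamDetermined : ∀ {Q T₀ T₁ T₂ T₃ T₄ : Graph n} {D₁ D₂ D₃ D₄} →
  Consistent Q T₀ T₁ → Consistent Q T₀ T₂ → Diam T₁ D₁ → Diam T₂ D₂ → D₁ ≢ D₂ →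
  Consistent Q T₀ T₃ → Consistent Q T₀ T₄ → Diam T₃ D₃ → Diam T₄ D₄ →
  (∀ {u w} → Dist T₃ u w D₃ → Dist T₄ u w D₄ → ⊥) →
  ¬ DiamDetermined Q T₀
¬diamDetermined c₁ c₂ d₁ d₂ D₁≢D₂ _ _ _ _ _ (inj₁ determined) = D₁≢D₂ (determined _ _ c₁ c₂ _ _ d₁ d₂)
¬diamDetermined _ _ _ _ _ c₃ c₄ d₃ d₄ disjoint (inj₂ (u , w , _ , pair)) =
  disjoint (pair _ c₃ _ d₃) (pair _ c₄ _ d₄)

-- A solo class will stand for exactly one
-- vertex; any other class is a leaf hanging from a solo class and stands for any number
-- (possibly zero) of twin leaves.
record IsClassTree {k : ℕ} (solo : Fin k → Bool) (δ : Fin k → Fin k → ℕ) : Set where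
  field
    δ-refl          : ∀ s → δ s s ≡ 0
    δ-sym           : ∀ s t → δ s t ≡ δ t s
    δ-level         : ∀ s r t → δ s r ≡ 1 → δ r t ≡ suc (δ s t) ⊎ δ s t ≡ suc (δ r t)
    next-hop        : ∀ s t → s ≢ t → ∃[ r ] δ s r ≡ 1 × δ s t ≡ suc (δ r t)
    next-hop-solo   : ∀ s r t → δ s r ≡ 1 → δ s t ≡ suc (δ r t) → r ≢ t → T (solo r)
    next-hop-unique : ∀ s r r′ t → δ s r ≡ 1 → δ s r′ ≡ 1 →
                      δ s t ≡ suc (δ r t) → δ s t ≡ suc (δ r′ t) → r ≡ r′
    crowd-leaf      : ∀ s → ¬ T (solo s) →
                      ∃[ r ] T (solo r) × δ s r ≡ 1 × (∀ r′ → δ s r′ ≡ 1 → r′ ≡ r)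

  δ-lipschitz : ∀ s r t → δ s r ≡ 1 → δ s t ≤ suc (δ r t)
  δ-lipschitz s r t s~r with δ-level s r t s~r
  ... | inj₁ up   = m≤n⇒m≤1+n (≤-trans (n≤1+n _) (≤-reflexive (sym up)))
  ... | inj₂ down = ≤-reflexive down

isClassTree? : ∀ {k} (solo : Fin k → Bool) (δ : Fin k → Fin k → ℕ) → Dec (IsClassTree solo δ)
isClassTree? solo δ =
  map′ (λ (a , b , c , d , e , f , g) → record
         { δ-refl = a ; δ-sym = b ; δ-level = c ; next-hop = d
         ; next-hop-solo = e ; next-hop-unique = f ; crowd-leaf = g })
       (λ t → let open IsClassTree t in
         δ-refl , δ-sym , δ-level , next-hop , next-hop-solo , next-hop-unique , crowd-leaf)
       ( all? (λ s → δ s s ≟ℕ 0)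
  ×-dec all? (λ s → all? λ t → δ s t ≟ℕ δ t s)
  ×-dec all? (λ s → all? λ r → all? λ t →
          δ s r ≟ℕ 1 →-dec (δ r t ≟ℕ suc (δ s t) ⊎-dec δ s t ≟ℕ suc (δ r t)))
  ×-dec all? (λ s → all? λ t → ¬? (s ≟ t) →-dec any? λ r → δ s r ≟ℕ 1 ×-dec δ s t ≟ℕ suc (δ r t))
  ×-dec all? (λ s → all? λ r → all? λ t →
          δ s r ≟ℕ 1 →-dec δ s t ≟ℕ suc (δ r t) →-dec ¬? (r ≟ t) →-dec T? (solo r))
  ×-dec all? (λ s → all? λ r → all? λ r′ → all? λ t →
          δ s r ≟ℕ 1 →-dec δ s r′ ≟ℕ 1 →-dec
          δ s t ≟ℕ suc (δ r t) →-dec δ s t ≟ℕ suc (δ r′ t) →-dec r ≟ r′)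
  ×-dec all? (λ s → ¬? (T? (solo s)) →-dec
          any? λ r → T? (solo r) ×-dec δ s r ≟ℕ 1 ×-dec all? λ r′ → δ s r′ ≟ℕ 1 →-dec r′ ≟ r))

module _ {k : ℕ} where
  open import Data.List.Membership.DecPropositional (_≟_ {k}) using (_∈?_)

  AgreeExcept : Fin k → List (Fin k) → (δ δ′ : Fin k → Fin k → ℕ) → Set
  AgreeExcept V H δ δ′ = ∀ s t → δ s t ≡ δ′ s t ⊎ (s ≡ V × t ∈ H) ⊎ (t ≡ V × s ∈ H)

  agreeExcept? : ∀ V H δ δ′ → Dec (AgreeExcept V H δ δ′)
  agreeExcept? V H δ δ′ = all? λ s → all? λ t →
    δ s t ≟ℕ δ′ s t ⊎-dec (s ≟ V ×-dec t ∈? H) ⊎-dec (t ≟ V ×-dec s ∈? H)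

  Bounded : (Fin k → Fin k → ℕ) → ℕ → Set
  Bounded δ D = ∀ s t → δ s t ≤ D

  bounded? : ∀ δ D → Dec (Bounded δ D)
  bounded? δ D = all? λ s → all? λ t → δ s t ≤? D

  NoCommonPair : (Fin k → Fin k → ℕ) → ℕ → (Fin k → Fin k → ℕ) → ℕ → Set
  NoCommonPair δ D δ′ D′ = ∀ s t → ¬ (δ s t ≡ D × δ′ s t ≡ D′)

  noCommonPair? : ∀ δ D δ′ D′ → Dec (NoCommonPair δ D δ′ D′)
  noCommonPair? δ D δ′ D′ = all? λ s → all? λ t → ¬? (δ s t ≟ℕ D ×-dec δ′ s t ≟ℕ D′)

matrix : ∀ {k} → Vec (Vec ℕ k) k → Fin k → Fin k → ℕ
matrix M s t = lookup (lookup M s) t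

module BlowUp {k} (cls : Fin n → Fin k) (solo : Fin k → Bool) (rep : Fin k → Fin n)
  (rep-sound : ∀ {s} → T (solo s) → cls (rep s) ≡ s)
  (solo-injective : ∀ {u w} → T (solo (cls u)) → cls u ≡ cls w → u ≡ w) where

  solo⇒rep : ∀ {u} → T (solo (cls u)) → u ≡ rep (cls u)
  solo⇒rep solo-u = solo-injective solo-u (sym (rep-sound solo-u))

  graph : ∀ {δ} → IsClassTree solo δ → Graph n
  graph {δ} tree = record
    { adj    = λ u w → δ (cls u) (cls w) ≡ᵇ 1
    ; sym    = λ u w → cong (_≡ᵇ 1) (δ-sym (cls u) (cls w))
    ; irrefl = λ u → cong (_≡ᵇ 1) (δ-refl (cls u))
    }
    where open IsClassTree tree

  dist : (Fin k → Fin k → ℕ) → Fin n → Fin n → ℕ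
  dist δ u w with u ≟ w | cls u ≟ cls w
  ... | yes _ | _     = 0
  ... | no _  | yes _ = 2
  ... | no _  | no _  = δ (cls u) (cls w)

  data DistView (δ : Fin k → Fin k → ℕ) (u w : Fin n) : ℕ → Set where
    same  : u ≡ w → DistView δ u w 0
    twins : u ≢ w → cls u ≡ cls w → DistView δ u w 2
    apart : cls u ≢ cls w → DistView δ u w (δ (cls u) (cls w))

  distView : ∀ δ u w → DistView δ u w (dist δ u w)
  distView δ u w with u ≟ w | cls u ≟ cls w
  ... | yes u≡w | _       = same u≡w
  ... | no u≢w  | yes u≈w = twins u≢w u≈w
  ... | no _    | no u≉w  = apart u≉w

  dist-self : ∀ δ w → dist δ w w ≡ 0
  dist-self δ w with dist δ w w | distView δ w w
  ... | _ | same _      = refl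
  ... | _ | twins w≢w _ = contradiction refl w≢w
  ... | _ | apart w≉w   = contradiction refl w≉w

  dist-apart : ∀ δ {u w} → cls u ≢ cls w → dist δ u w ≡ δ (cls u) (cls w)
  dist-apart δ {u} {w} u≉w with dist δ u w | distView δ u w
  ... | _ | same refl   = contradiction refl u≉w
  ... | _ | twins _ u≈w = contradiction u≈w u≉w
  ... | _ | apart _     = refl

  dist-agree : ∀ δ δ′ {u w} → (cls u ≢ cls w → δ (cls u) (cls w) ≡ δ′ (cls u) (cls w)) →
               dist δ u w ≡ dist δ′ u w
  dist-agree δ δ′ {u} {w} agree with u ≟ w | cls u ≟ cls w
  ... | yes _ | _       = refl
  ... | no _  | yes _   = refl
  ... | no _  | no u≉w  = agree u≉w

  module _ {δ} (tree : IsClassTree solo δ) where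
    open IsClassTree tree

    private
      G : Graph n
      G = graph tree

      adj⇒δ≡1 : ∀ {u w} → Adj G u w → δ (cls u) (cls w) ≡ 1
      adj⇒δ≡1 u~w = ≡ᵇ⇒≡ _ 1 (Equivalence.from T-≡ u~w)

      δ≡1⇒adj : ∀ {u w} → δ (cls u) (cls w) ≡ 1 → Adj G u w
      δ≡1⇒adj δ≡1 = Equivalence.to T-≡ (≡⇒≡ᵇ _ 1 δ≡1)

      adjacent-classes-differ : ∀ {u w} → Adj G u w → cls u ≢ cls w
      adjacent-classes-differ {u} u~w u≈w
        with () ← trans (sym (δ-refl (cls u))) (trans (cong (δ (cls u)) u≈w) (adj⇒δ≡1 u~w))

      dist-lipschitz : ∀ {u m} w → Adj G u m → dist δ u w ≤ suc (dist δ m w)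
      dist-lipschitz {u} {m} w u~m
        with dist δ u w | distView δ u w | dist δ m w | distView δ m w
      ... | _ | same _      | _ | _             = z≤n
      ... | _ | twins _ u≈w | _ | same refl     = contradiction u≈w (adjacent-classes-differ u~m)
      ... | _ | twins _ u≈w | _ | twins _ m≈w   =
        contradiction (trans u≈w (sym m≈w)) (adjacent-classes-differ u~m)
      ... | _ | twins _ u≈w | _ | apart _       = s≤s (≤-reflexive (sym
        (trans (δ-sym (cls m) (cls w)) (trans (cong (λ s → δ s (cls m)) (sym u≈w)) (adj⇒δ≡1 u~m)))))
      ... | _ | apart _     | _ | same refl     = ≤-reflexive (adj⇒δ≡1 u~m)
      ... | _ | apart _     | _ | twins _ m≈w   =
        ≤-trans (≤-reflexive (trans (cong (δ (cls u)) (sym m≈w)) (adj⇒δ≡1 u~m))) (s≤s z≤n)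
      ... | _ | apart _     | _ | apart _       = δ-lipschitz (cls u) (cls m) (cls w) (adj⇒δ≡1 u~m)

      descend-via : ∀ {u} {d : ℕ} w r → T (solo r) → δ (cls u) r ≡ 1 → r ≢ cls w → d ≡ suc (δ r (cls w)) →
                    ∃[ m ] Adj G u m × d ≡ suc (dist δ m w)
      descend-via {u} w r solo-r u~r r≉w d≡1+δ =
        rep r ,
        δ≡1⇒adj (trans (cong (δ (cls u)) m∈r) u~r) ,
        trans d≡1+δ (cong suc (sym (trans (dist-apart δ (λ m≈w → r≉w (trans (sym m∈r) m≈w)))
                                          (cong (λ s → δ s (cls w)) m∈r))))
        where
          m∈r : cls (rep r) ≡ r
          m∈r = rep-sound solo-r

      dist-descent : ∀ {u} w → u ≢ w → ∃[ m ] Adj G u m × dist δ u w ≡ suc (dist δ m w)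
      dist-descent {u} w u≢w with dist δ u w | distView δ u w
      ... | _ | same u≡w    = contradiction u≡w u≢w
      ... | _ | twins _ u≈w with crowd-leaf (cls u) (λ solo-u → u≢w (solo-injective solo-u u≈w))
      ...   | r , solo-r , u~r , _ =
        descend-via w r solo-r u~r r≉w (cong suc (sym (trans (δ-sym r (cls w)) w~r)))
        where
          w~r : δ (cls w) r ≡ 1
          w~r = trans (cong (λ s → δ s r) (sym u≈w)) u~r
          r≉w : r ≢ cls w
          r≉w r≡w with () ← trans (sym (δ-refl (cls w))) (trans (cong (δ (cls w)) (sym r≡w)) w~r)
      dist-descent {u} w u≢w | _ | apart u≉w with next-hop (cls u) (cls w) u≉w
      ... | r , u~r , hop with r ≟ cls w
      ...   | no r≉w   = descend-via w r (next-hop-solo (cls u) r (cls w) u~r hop r≉w) u~r r≉w hop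
      ...   | yes refl =
        w , δ≡1⇒adj (trans hop (cong suc (δ-refl r))) ,
        trans hop (cong suc (trans (δ-refl r) (sym (dist-self δ w))))

    dist-correct : ∀ u w → Dist G u w (dist δ u w)
    dist-correct u w =
      potential⇒Dist w (λ u → dist δ u w) (dist-self δ w) (dist-lipschitz w) (dist-descent w) u

    private
      levelling : ∀ x → T (solo (cls x)) → RootedLevelling G x
      levelling x solo-x = record
        { level         = λ u → δ (cls u) (cls x)
        ; level-root    = δ-refl (cls x)
        ; level-step    = λ u~w → δ-level _ _ (cls x) (adj⇒δ≡1 u~w)
        ; parent-unique = parent-unique
        }
        where
          parent-unique : ∀ {u w w′} → Adj G u w → Adj G u w′ →
            δ (cls u) (cls x) ≡ suc (δ (cls w) (cls x)) → δ (cls u) (cls x) ≡ suc (δ (cls w′) (cls x)) →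
            w ≡ w′
          parent-unique {u} {w} {w′} u~w u~w′ hop hop′ = solo-injective solo-w same-class
            where
              same-class : cls w ≡ cls w′
              same-class =
                next-hop-unique (cls u) (cls w) (cls w′) (cls x) (adj⇒δ≡1 u~w) (adj⇒δ≡1 u~w′) hop hop′
              solo-w : T (solo (cls w))
              solo-w with cls w ≟ cls x
              ... | yes w≈x = subst (T ∘ solo) (sym w≈x) solo-x
              ... | no w≉x  = next-hop-solo (cls u) (cls w) (cls x) (adj⇒δ≡1 u~w) hop w≉x

      crowd-is-leaf : ∀ x → ¬ T (solo (cls x)) → Leaf G x
      crowd-is-leaf x crowd {y} {z} x~y x~z with crowd-leaf (cls x) crowd
      ... | r , solo-r , _ , only-r =
        solo-injective (subst (T ∘ solo) (sym y∈r) solo-r) (trans y∈r (sym z∈r))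
        where
          y∈r : cls y ≡ r
          y∈r = only-r _ (adj⇒δ≡1 x~y)
          z∈r : cls z ≡ r
          z∈r = only-r _ (adj⇒δ≡1 x~z)

    isTree : IsTree G
    isTree = (λ u w → dist δ u w , proj₁ (dist-correct u w)) , levelled⇒acyclic leaf-or-root
      where
        leaf-or-root : ∀ x → Leaf G x ⊎ RootedLevelling G x
        leaf-or-root x with T? (solo (cls x))
        ... | yes solo-x = inj₂ (levelling x solo-x)
        ... | no crowd   = inj₁ (crowd-is-leaf x crowd)

    diam : ∀ {D} s t → T (solo s) → T (solo t) → s ≢ t → δ s t ≡ D → Bounded δ D → 2 ≤ D → Diam G D
    diam {D} s t solo-s solo-t s≢t δst≡D bound 2≤D = (rep s , rep t , realised) , below
      where
        realised : Dist G (rep s) (rep t) D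
        realised = subst (Dist G (rep s) (rep t))
          (trans (dist-apart δ (λ eq → s≢t (trans (sym (rep-sound solo-s)) (trans eq (rep-sound solo-t)))))
                 (trans (cong₂ δ (rep-sound solo-s) (rep-sound solo-t)) δst≡D))
          (dist-correct (rep s) (rep t))
        below : ∀ u w k → Dist G u w k → k ≤ D
        below u w k d rewrite Dist-unique d (dist-correct u w) with dist δ u w | distView δ u w
        ... | _ | same _    = z≤n
        ... | _ | twins _ _ = 2≤D
        ... | _ | apart _   = bound (cls u) (cls w)

    diametral-apart : ∀ {u w D} → 3 ≤ D → Dist G u w D → δ (cls u) (cls w) ≡ D
    diametral-apart {u} {w} 3≤D d rewrite Dist-unique d (dist-correct u w) with dist δ u w | distView δ u w
    ... | _ | same _    with () ← 3≤D
    ... | _ | twins _ _ with s≤s (s≤s ()) ← 3≤D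
    ... | _ | apart _   = refl

  consistent : ∀ {Q δ δ′} (tree : IsClassTree solo δ) (tree′ : IsClassTree solo δ′) →
    (∀ {u w} → Adj Q u w → cls u ≢ cls w → δ (cls u) (cls w) ≡ δ′ (cls u) (cls w)) →
    Consistent Q (graph tree) (graph tree′)
  consistent {δ = δ} {δ′} tree tree′ agree = isTree tree′ , λ u w q k d →
    subst (Dist (graph tree′) u w)
      (trans (sym (dist-agree δ δ′ (agree q))) (sym (Dist-unique d (dist-correct tree u w))))
      (dist-correct tree′ u w)

  unqueried-classes : ∀ {Q : Graph n} {V H} → T (solo V) → All (T ∘ solo) H →
    All (λ t → adj Q (rep V) (rep t) ≡ false) H → ∀ {u w} → cls u ≡ V → cls w ∈ H → adj Q u w ≡ false
  unqueried-classes {Q} {V} solo-V solo-H unqueried {u} {w} u∈V w∈H =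
    subst₂ (λ a b → adj Q a b ≡ false) (sym u≡repV) (sym (solo⇒rep (All.lookup solo-H w∈H)))
      (All.lookup unqueried w∈H)
    where
      u≡repV : u ≡ rep V
      u≡repV = solo-injective (subst (T ∘ solo) (sym u∈V) solo-V) (trans u∈V (sym (rep-sound solo-V)))

  agree-on-queries : ∀ {Q : Graph n} {V H δ δ′} → T (solo V) → All (T ∘ solo) H →
    All (λ t → adj Q (rep V) (rep t) ≡ false) H → AgreeExcept V H δ δ′ →
    ∀ {u w} → Adj Q u w → cls u ≢ cls w → δ (cls u) (cls w) ≡ δ′ (cls u) (cls w)
  agree-on-queries {Q} {V} solo-V solo-H unqueried agree {u} {w} u~w _ with agree (cls u) (cls w)
  ... | inj₁ eq = eq
  ... | inj₂ (inj₁ (u∈V , w∈H)) with () ←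
    trans (sym (unqueried-classes {Q} {V} solo-V solo-H unqueried u∈V w∈H)) u~w
  ... | inj₂ (inj₂ (w∈V , u∈H)) with () ←
    trans (sym (unqueried-classes {Q} {V} solo-V solo-H unqueried w∈V u∈H)) (trans (Graph.sym Q w u) u~w)

  no-common-diametral-pair : ∀ {δ δ′ D D′} (tree : IsClassTree solo δ) (tree′ : IsClassTree solo δ′) →
    3 ≤ D → 3 ≤ D′ → NoCommonPair δ D δ′ D′ →
    ∀ {u w} → Dist (graph tree) u w D → Dist (graph tree′) u w D′ → ⊥
  no-common-diametral-pair tree tree′ 3≤D 3≤D′ disjoint {u} {w} d d′ =
    disjoint (cls u) (cls w) (diametral-apart tree 3≤D d , diametral-apart tree′ 3≤D′ d′)

lookup-injective : ∀ {A : Set} {xs : List A} → Unique xs →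
                   ∀ {i j} → List.lookup xs i ≡ List.lookup xs j → i ≡ j
lookup-injective {xs = _ ∷ _} _          {zero}  {zero}  _  = refl
lookup-injective {xs = _ ∷ _} (x∉ ∷ _)   {zero}  {suc j} eq =
  contradiction eq (All.lookup x∉ (∈-lookup j))
lookup-injective {xs = _ ∷ _} (x∉ ∷ _)   {suc i} {zero}  eq =
  contradiction (sym eq) (All.lookup x∉ (∈-lookup i))
lookup-injective {xs = _ ∷ _} (_ ∷ uniq) {suc i} {suc j} eq = cong suc (lookup-injective uniq eq)

module Named (names : List (Fin n)) (distinct : Unique names) where
  open import Data.List.Membership.DecPropositional (_≟_ {n}) using (_∈?_)

  classOf : Fin n → Fin (suc (length names))
  classOf u with u ∈? names
  ... | yes u∈names = suc (index u∈names)
  ... | no _        = zero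

  -- Class zero collects the unnamed vertices; z stands for it, which is meaningful only when
  -- z is its sole member.
  rep : Fin n → Fin (suc (length names)) → Fin n
  rep z zero    = z
  rep _ (suc i) = List.lookup names i

  classOf-lookup : ∀ i → classOf (List.lookup names i) ≡ suc i
  classOf-lookup i with List.lookup names i ∈? names
  ... | yes p = cong suc (lookup-injective distinct (sym (lookup-index p)))
  ... | no ∉  = contradiction (∈-lookup i) ∉

  classOf-suc : ∀ {u i} → classOf u ≡ suc i → u ≡ List.lookup names i
  classOf-suc {u} eq with u ∈? names
  classOf-suc refl | yes p = lookup-index p

  classOf-zero : ∀ {u} → classOf u ≡ zero → u ∉ names
  classOf-zero {u} eq with u ∈? names
  classOf-zero () | yes _
  ... | no ∉ = ∉

  classOf-∉ : ∀ {u} → u ∉ names → classOf u ≡ zero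
  classOf-∉ {u} u∉ with u ∈? names
  ... | yes u∈ = contradiction u∈ u∉
  ... | no _   = refl

  classOf-injective : ∀ {u w i} → classOf u ≡ suc i → classOf u ≡ classOf w → u ≡ w
  classOf-injective u∈i u≈w = trans (classOf-suc u∈i) (sym (classOf-suc (trans (sym u≈w) u∈i)))

unique₄ : ∀ {v a b c : Fin n} → v ≢ a → v ≢ b → v ≢ c → a ≢ b → a ≢ c → b ≢ c →
          Unique (v ∷ a ∷ b ∷ c ∷ [])
unique₄ v≢a v≢b v≢c a≢b a≢c b≢c = (v≢a ∷ v≢b ∷ v≢c ∷ []) ∷ (a≢b ∷ a≢c ∷ []) ∷ (b≢c ∷ []) ∷ [] ∷ []

three-avoiding : ∀ {P : Fin n → Set} v (l : List (Fin n)) → Unique l → All P l → 4 ≤ length l →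
  ∃[ a ] ∃[ b ] ∃[ c ] Unique (v ∷ a ∷ b ∷ c ∷ []) × All P (a ∷ b ∷ c ∷ [])
three-avoiding v (p ∷ q ∷ r ∷ s ∷ _)
  ((p≢q ∷ p≢r ∷ p≢s ∷ _) ∷ (q≢r ∷ q≢s ∷ _) ∷ (r≢s ∷ _) ∷ _) (Pp ∷ Pq ∷ Pr ∷ Ps ∷ _) _
  with p ≟ v | q ≟ v | r ≟ v
... | yes refl | _        | _        =
  q , r , s , unique₄ p≢q p≢r p≢s q≢r q≢s r≢s , Pq ∷ Pr ∷ Ps ∷ []
... | no p≢v   | yes refl | _        =
  p , r , s , unique₄ (≢-sym p≢v) q≢r q≢s p≢r p≢s r≢s , Pp ∷ Pr ∷ Ps ∷ []
... | no p≢v   | no q≢v   | yes refl =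
  p , q , s , unique₄ (≢-sym p≢v) (≢-sym q≢v) r≢s p≢q p≢s q≢s , Pp ∷ Pq ∷ Ps ∷ []
... | no p≢v   | no q≢v   | no r≢v   =
  p , q , r , unique₄ (≢-sym p≢v) (≢-sym q≢v) (≢-sym r≢v) p≢q p≢r q≢r , Pp ∷ Pq ∷ Pr ∷ []
three-avoiding _ []                _ _ ()
three-avoiding _ (_ ∷ [])          _ _ (s≤s ())
three-avoiding _ (_ ∷ _ ∷ [])      _ _ (s≤s (s≤s ()))
three-avoiding _ (_ ∷ _ ∷ _ ∷ [])  _ _ (s≤s (s≤s (s≤s ())))

module _ (Q : Graph n) (v : Fin n) where

  nonNeighbours : List (Fin n)
  nonNeighbours = filter (λ w → adj Q v w Bool.≟ false) (allFin n)

  private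
    degree-split : ∀ l → sum (List.map (λ w → if adj Q v w then 1 else 0) l) +
                         length (filter (λ w → adj Q v w Bool.≟ false) l) ≡ length l
    degree-split []      = refl
    degree-split (w ∷ l) with adj Q v w
    ... | true  = cong suc (degree-split l)
    ... | false = trans (+-suc _ _) (cong suc (degree-split l))

  degree+nonNeighbours : degree Q v + length nonNeighbours ≡ n
  degree+nonNeighbours = trans (degree-split (allFin n)) (length-tabulate (λ i → i))

  three-non-neighbours : ¬ (n ∸ 3 ≤ degree Q v) →
    ∃[ a ] ∃[ b ] ∃[ c ] Unique (v ∷ a ∷ b ∷ c ∷ []) × All (λ w → adj Q v w ≡ false) (a ∷ b ∷ c ∷ [])
  three-non-neighbours high with 4 ≤? length nonNeighbours
  ... | yes many =
    three-avoiding v nonNeighbours (Unique.filter⁺ _ (allFin⁺ n)) (all-filter _ (allFin n)) many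
  ... | no few   = contradiction low high
    where
      low : n ∸ 3 ≤ degree Q v
      low = begin
        n ∸ 3                                 ≡⟨ cong (_∸ 3) (sym degree+nonNeighbours) ⟩
        degree Q v + length nonNeighbours ∸ 3 ≤⟨ ∸-monoˡ-≤ 3 (+-monoʳ-≤ (degree Q v) (≤-pred (≰⇒> few))) ⟩
        degree Q v + 3 ∸ 3                    ≡⟨ m+n∸n≡m (degree Q v) 3 ⟩
        degree Q v                            ∎
        where open ≤-Reasoning

module _ {n : ℕ} where
  open import Data.List.Membership.DecPropositional (_≟_ {n}) using (_∈?_; _∉?_)

  everyone-or-outsider : (l : List (Fin n)) → (∀ u → u ∈ l) ⊎ ∃[ x ] x ∉ l
  everyone-or-outsider l with any? (λ x → x ∉? l)
  ... | yes outsider = inj₂ outsider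
  ... | no none      = inj₁ λ u → decidable-stable (u ∈? l) λ u∉l → none (u , u∉l)

module FiveOrMore (Q : Graph n) (v a b c x : Fin n) (distinct : Unique (x ∷ v ∷ a ∷ b ∷ c ∷ []))
  (unqueried : All (λ w → adj Q v w ≡ false) (a ∷ b ∷ c ∷ [])) where

  open Named (x ∷ v ∷ a ∷ b ∷ c ∷ []) distinct

  solo : Fin 6 → Bool
  solo zero    = false
  solo (suc _) = true

  rep-sound : ∀ {s} → T (solo s) → classOf (rep v s) ≡ s
  rep-sound {suc i} _ = classOf-lookup i

  solo-injective : ∀ {u w} → T (solo (classOf u)) → classOf u ≡ classOf w → u ≡ w
  solo-injective {u} solo-u u≈w with classOf u in u∈
  ... | suc i = classOf-injective u∈ (trans u∈ u≈w)

  open BlowUp classOf solo (rep v) rep-sound solo-injective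

  -- Classes: 0 = the remaining vertices, 1 = x, 2 = v, 3 = a, 4 = b, 5 = c.
  -- δ₁ is the tree with edges v–a, a–c, a–x, b–x and every remaining vertex joined to x;
  -- δ₂ is the same tree with v hanging from b instead of a.
  δ₁ δ₂ : Fin 6 → Fin 6 → ℕ
  δ₁ = matrix
    ( (0 ∷ 1 ∷ 3 ∷ 2 ∷ 2 ∷ 3 ∷ [])
    ∷ (1 ∷ 0 ∷ 2 ∷ 1 ∷ 1 ∷ 2 ∷ [])
    ∷ (3 ∷ 2 ∷ 0 ∷ 1 ∷ 3 ∷ 2 ∷ [])
    ∷ (2 ∷ 1 ∷ 1 ∷ 0 ∷ 2 ∷ 1 ∷ [])
    ∷ (2 ∷ 1 ∷ 3 ∷ 2 ∷ 0 ∷ 3 ∷ [])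
    ∷ (3 ∷ 2 ∷ 2 ∷ 1 ∷ 3 ∷ 0 ∷ [])
    ∷ [])
  δ₂ = matrix
    ( (0 ∷ 1 ∷ 3 ∷ 2 ∷ 2 ∷ 3 ∷ [])
    ∷ (1 ∷ 0 ∷ 2 ∷ 1 ∷ 1 ∷ 2 ∷ [])
    ∷ (3 ∷ 2 ∷ 0 ∷ 3 ∷ 1 ∷ 4 ∷ [])
    ∷ (2 ∷ 1 ∷ 3 ∷ 0 ∷ 2 ∷ 1 ∷ [])
    ∷ (2 ∷ 1 ∷ 1 ∷ 2 ∷ 0 ∷ 3 ∷ [])
    ∷ (3 ∷ 2 ∷ 4 ∷ 1 ∷ 3 ∷ 0 ∷ [])
    ∷ [])

  tree₁ : IsClassTree solo δ₁
  tree₁ = from-yes (isClassTree? solo δ₁)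

  tree₂ : IsClassTree solo δ₂
  tree₂ = from-yes (isClassTree? solo δ₂)

  ¬all-determined : ¬ (∀ T → IsTree T → DiamDetermined Q T)
  ¬all-determined determined =
    ¬diamDetermined {Q = Q} stay move diam₁ diam₂ (λ ()) stay move diam₁ diam₂
      (no-common-diametral-pair tree₁ tree₂ ≤-refl (n≤1+n 3) (from-yes (noCommonPair? δ₁ 3 δ₂ 4)))
      (determined _ (isTree tree₁))
    where
      stay : Consistent Q (graph tree₁) (graph tree₁)
      stay = consistent {Q = Q} tree₁ tree₁ (λ _ _ → refl)
      move : Consistent Q (graph tree₁) (graph tree₂)
      move = consistent {Q = Q} tree₁ tree₂
        (agree-on-queries {Q = Q} {V = # 2} {H = # 3 ∷ # 4 ∷ # 5 ∷ []} _ (_ ∷ _ ∷ _ ∷ [])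
          (All.map⁻ {f = rep v} unqueried) (from-yes (agreeExcept? (# 2) (# 3 ∷ # 4 ∷ # 5 ∷ []) δ₁ δ₂)))
      diam₁ : Diam (graph tree₁) 3
      diam₁ = diam tree₁ (# 2) (# 4) _ _ (λ ()) refl (from-yes (bounded? δ₁ 3)) (s≤s (s≤s z≤n))
      diam₂ : Diam (graph tree₂) 4
      diam₂ = diam tree₂ (# 2) (# 5) _ _ (λ ()) refl (from-yes (bounded? δ₂ 4)) (s≤s (s≤s z≤n))

module Four (Q : Graph n) (v a b c : Fin n) (distinct : Unique (v ∷ a ∷ b ∷ c ∷ []))
  (unqueried : All (λ w → adj Q v w ≡ false) (a ∷ b ∷ c ∷ []))
  (everyone : ∀ u → u ∈ v ∷ a ∷ b ∷ c ∷ []) where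

  private
    v∉abc : v ∉ a ∷ b ∷ c ∷ []
    v∉abc = All¬⇒¬Any (AllPairs.head distinct)

  open Named (a ∷ b ∷ c ∷ []) (AllPairs.tail distinct)

  unnamed-is-v : ∀ {u} → u ∉ a ∷ b ∷ c ∷ [] → u ≡ v
  unnamed-is-v {u} u∉ with everyone u
  ... | here u≡v     = u≡v
  ... | there u∈abc  = contradiction u∈abc u∉

  solo : Fin 4 → Bool
  solo _ = true

  rep-sound : ∀ {s} → T (solo s) → classOf (rep v s) ≡ s
  rep-sound {zero}  _ = classOf-∉ v∉abc
  rep-sound {suc i} _ = classOf-lookup i

  solo-injective : ∀ {u w} → T (solo (classOf u)) → classOf u ≡ classOf w → u ≡ w
  solo-injective {u} _ u≈w with classOf u in u∈
  ... | suc i = classOf-injective u∈ (trans u∈ u≈w)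
  ... | zero  = trans (unnamed-is-v (classOf-zero u∈)) (sym (unnamed-is-v (classOf-zero (sym u≈w))))

  open BlowUp classOf solo (rep v) rep-sound solo-injective

  -- Classes: 0 = v, 1 = a, 2 = b, 3 = c.  δ₀ is the star centred at a; in δ₁ and δ₂
  -- the leaf v is moved to b and to c respectively.
  δ₀ δ₁ δ₂ : Fin 4 → Fin 4 → ℕ
  δ₀ = matrix
    ( (0 ∷ 1 ∷ 2 ∷ 2 ∷ [])
    ∷ (1 ∷ 0 ∷ 1 ∷ 1 ∷ [])
    ∷ (2 ∷ 1 ∷ 0 ∷ 2 ∷ [])
    ∷ (2 ∷ 1 ∷ 2 ∷ 0 ∷ [])
    ∷ [])
  δ₁ = matrix
    ( (0 ∷ 2 ∷ 1 ∷ 3 ∷ [])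
    ∷ (2 ∷ 0 ∷ 1 ∷ 1 ∷ [])
    ∷ (1 ∷ 1 ∷ 0 ∷ 2 ∷ [])
    ∷ (3 ∷ 1 ∷ 2 ∷ 0 ∷ [])
    ∷ [])
  δ₂ = matrix
    ( (0 ∷ 2 ∷ 3 ∷ 1 ∷ [])
    ∷ (2 ∷ 0 ∷ 1 ∷ 1 ∷ [])
    ∷ (3 ∷ 1 ∷ 0 ∷ 2 ∷ [])
    ∷ (1 ∷ 1 ∷ 2 ∷ 0 ∷ [])
    ∷ [])

  tree₀ : IsClassTree solo δ₀
  tree₀ = from-yes (isClassTree? solo δ₀)

  tree₁ : IsClassTree solo δ₁
  tree₁ = from-yes (isClassTree? solo δ₁)

  tree₂ : IsClassTree solo δ₂
  tree₂ = from-yes (isClassTree? solo δ₂)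

  ¬all-determined : ¬ (∀ T → IsTree T → DiamDetermined Q T)
  ¬all-determined determined =
    ¬diamDetermined {Q = Q} stay move₁ diam₀ diam₁ (λ ()) move₁ move₂ diam₁ diam₂
      (no-common-diametral-pair tree₁ tree₂ ≤-refl ≤-refl (from-yes (noCommonPair? δ₁ 3 δ₂ 3)))
      (determined _ (isTree tree₀))
    where
      move : ∀ {δ} (tree : IsClassTree solo δ) → AgreeExcept zero (# 1 ∷ # 2 ∷ # 3 ∷ []) δ₀ δ →
             Consistent Q (graph tree₀) (graph tree)
      move tree agree = consistent {Q = Q} tree₀ tree
        (agree-on-queries {Q = Q} _ (_ ∷ _ ∷ _ ∷ []) (All.map⁻ {f = rep v} unqueried) agree)
      stay : Consistent Q (graph tree₀) (graph tree₀)
      stay = consistent {Q = Q} tree₀ tree₀ (λ _ _ → refl)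
      move₁ : Consistent Q (graph tree₀) (graph tree₁)
      move₁ = move tree₁ (from-yes (agreeExcept? zero (# 1 ∷ # 2 ∷ # 3 ∷ []) δ₀ δ₁))
      move₂ : Consistent Q (graph tree₀) (graph tree₂)
      move₂ = move tree₂ (from-yes (agreeExcept? zero (# 1 ∷ # 2 ∷ # 3 ∷ []) δ₀ δ₂))
      diam₀ : Diam (graph tree₀) 2
      diam₀ = diam tree₀ zero (# 2) _ _ (λ ()) refl (from-yes (bounded? δ₀ 2)) ≤-refl
      diam₁ : Diam (graph tree₁) 3
      diam₁ = diam tree₁ zero (# 3) _ _ (λ ()) refl (from-yes (bounded? δ₁ 3)) (n≤1+n 2)
      diam₂ : Diam (graph tree₂) 3
      diam₂ = diam tree₂ zero (# 2) _ _ (λ ()) refl (from-yes (bounded? δ₂ 3)) (n≤1+n 2)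

lemma2p5 : (n : ℕ) (Q : Graph n) →
    (∀ T → IsTree T → DiamDetermined Q T) →
    ∀ (v : Fin n) → n ∸ 3 ≤ degree Q v
lemma2p5 n Q determined v with n ∸ 3 ≤? degree Q v
... | yes low = low
... | no high with three-non-neighbours Q v high
... | a , b , c , distinct , unqueried with everyone-or-outsider (v ∷ a ∷ b ∷ c ∷ [])
...   | inj₁ everyone = ⊥-elim (Four.¬all-determined Q v a b c distinct unqueried everyone determined)
...   | inj₂ (x , x∉) =
  ⊥-elim (FiveOrMore.¬all-determined Q v a b c x (¬Any⇒All¬ _ x∉ ∷ distinct) unqueried determined)
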